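{- Let $G$ be a chordal bipartite graph with weak-simplicial elimination ordering $v_1,\dots,v_n$, let $\mathcal{H}$ be its hypergraph of closed neighborhoods, let $i\in\{1,\dots,n-1\}$, $T^\star\in Tr(\mathcal{H}_i)$, and let $\Delta_{i+1}$, $B$, $R$ be as in the context. Then every $Z\in Tr(\Delta_{i+1})$ satisfies $|Z\cap R\cap N(v_{i+1})|\le 1$ and $|Z\cap N^2(v_{i+1})|\le 1$.
   Context: A bipartite graph is chordal bipartite if it has no induced cycle of length greater than four. $N(v)$ and $N[v]=N(v)\cup\{v\}$ are the open and closed neighborhoods of $v$ in $G$, and $N^2(v)=N[N[v]]\setminus N[v]$ (vertices at distance exactly 2). For $1\le j\le n$ let $G_j=G[\{v_1,\dots,v_j\}]$. A vertex $v$ of a graph is weak-simplicial if $N(v)$ is an independent set and for any $x,y\in N(v)$ we have $N(x)\subseteq N(y)$ or $N(y)\subseteq N(x)$; $v_1,\dots,v_n$ is a weak-simplicial elimination ordering if each $v_j$ is weak-simplicial in $G_j$. The hypergraph of closed neighborhoods is $\mathcal{H}$ with vertex set $V(G)$ and hyperedges $\{N[v]: v\in V(G)\}$. For a hypergraph, $Tr(\cdot)$ is the set of inclusion-wise minimal transversals (sets meeting every hyperedge). $V_i=\{v_1,\dots,v_i\}$ and $\mathcal{H}_i$ has vertex set $V_i$ and hyperedges those $N[v]$ with $N[v]\subseteq V_i$. $\Delta_{i+1}=\{E\in E(\mathcal{H}_{i+1}): E\cap T^\star=\emptyset\}$. $B$ is the set of $u\in N(v_{i+1})$ with $N[u]\in\Delta_{i+1}$,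 and $R=\left(\bigcup_{E\in\Delta_{i+1}}E\right)\setminus B$. -}

module Defs where

open import Level using (0ℓ)
open import Data.Nat using (ℕ; zero; suc; _+_; _<_; _≤_; _%_)
open import Data.Bool using (Bool; T)
open import Data.Fin using (Fin; toℕ)
open import Data.Product using (Σ; ∃; _×_; _,_)
open import Data.Sum using (_⊎_)
open import Relation.Nullary using (¬_)
open import Relation.Binary.PropositionalEquality using (_≡_)
open import Relation.Unary using (Pred; _∈_; _∉_; _⊆_)
open import Function.Definitions using (Injective)

-- The vertex with index k (k = 0 … n-1) is v_{k+1} of the paper, so the
-- elimination ordering v_1,…,v_n is the natural order of Fin n.
record Graph (n : ℕ) : Set where
  field
    adj   : Fin n → Fin n → Bool
    sym   : ∀ u v → T (adj u v) → T (adj v u)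
    irrefl : ∀ v → ¬ T (adj v v)

module _ {n : ℕ} (G : Graph n) where
  open Graph G

  Adj : Fin n → Fin n → Set
  Adj u v = T (adj u v)

  IsBipartite : Set
  IsBipartite = Σ (Fin n → Bool) λ c → ∀ u v → Adj u v → ¬ (c u ≡ c v)

  CycConsec : (m : ℕ) → Fin (5 + m) → Fin (5 + m) → Set
  CycConsec m a b = (toℕ b ≡ suc (toℕ a) % (5 + m)) ⊎ (toℕ a ≡ suc (toℕ b) % (5 + m))

  InducedCycle : (m : ℕ) → Set
  InducedCycle m = Σ (Fin (5 + m) → Fin n) λ f →
    Injective _≡_ _≡_ f × (∀ a b → (Adj (f a) (f b) → CycConsec m a b)
                                 × (CycConsec m a b → Adj (f a) (f b)))

  IsChordalBipartite : Set
  IsChordalBipartite = IsBipartite × (∀ m → ¬ InducedCycle m)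

  N : Fin n → Pred (Fin n) 0ℓ
  N v u = Adj v u

  N[_] : Fin n → Pred (Fin n) 0ℓ
  N[ v ] u = (u ≡ v) ⊎ Adj v u

  N² : Fin n → Pred (Fin n) 0ℓ
  N² v u = (∃ λ w → w ∈ N[ v ] × u ∈ N[ w ]) × u ∉ N[ v ]

  -- V_j = {v_1,…,v_j} = vertices of index < j
  V : ℕ → Pred (Fin n) 0ℓ
  V j u = toℕ u < j

  Nind : ℕ → Fin n → Pred (Fin n) 0ℓ
  Nind j x u = u ∈ V j × Adj x u

  WeakSimplicialIn : ℕ → Fin n → Set
  WeakSimplicialIn j v =
    (∀ x y → x ∈ Nind j v → y ∈ Nind j v → ¬ Adj x y) ×
    (∀ x y → x ∈ Nind j v → y ∈ Nind j v → (Nind j x ⊆ Nind j y) ⊎ (Nind j y ⊆ Nind j x))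

  -- the natural order v_1,…,v_n is a weak-simplicial elimination ordering:
  -- v_j (index j-1) is weak-simplicial in G_j
  IsWSEO : Set
  IsWSEO = ∀ v → WeakSimplicialIn (suc (toℕ v)) v

-- A hypergraph's edge family is given as a predicate
-- on Fin n naming the vertices w whose closed neighbourhood N[w] is an edge
-- (several w with equal N[w] give the same edge; this does not affect Tr).
module _ {n : ℕ} where
  IsTransversal : (Fin n → Pred (Fin n) 0ℓ) → Pred (Fin n) 0ℓ → Pred (Fin n) 0ℓ → Set
  IsTransversal E idx Z = ∀ w → w ∈ idx → ∃ λ x → x ∈ Z × x ∈ E w

  IsMinTransversal : (Fin n → Pred (Fin n) 0ℓ) → Pred (Fin n) 0ℓ → Pred (Fin n) 0ℓ → Set₁
  IsMinTransversal E idx Z =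
    IsTransversal E idx Z × (∀ Z' → Z' ⊆ Z → IsTransversal E idx Z' → Z ⊆ Z')

  AtMostOne : Pred (Fin n) 0ℓ → Set
  AtMostOne S = ∀ x y → x ∈ S → y ∈ S → x ≡ y

module _ {n : ℕ} (G : Graph n) where
  H-idx : ℕ → Pred (Fin n) 0ℓ
  H-idx j w = N[_] G w ⊆ V G j

  Δ-idx : ℕ → Pred (Fin n) 0ℓ → Pred (Fin n) 0ℓ
  Δ-idx j T w = w ∈ H-idx j × (∀ x → x ∈ N[_] G w → x ∉ T)

  Bset : ℕ → Pred (Fin n) 0ℓ → Fin n → Pred (Fin n) 0ℓ
  Bset j T v u = u ∈ N G v × u ∈ Δ-idx j T

  Rset : ℕ → Pred (Fin n) 0ℓ → Fin n → Pred (Fin n) 0ℓ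
  Rset j T v x = (∃ λ w → w ∈ Δ-idx j T × x ∈ N[_] G w) × x ∉ Bset j T v

{-# OPTIONS --safe #-}
module Submission where

-- Every hyperedge N[w] of Δ_{i+1} contains v = v_{i+1}: otherwise N[w] ⊆ V_i is
-- an edge of H_i and so meets T⋆.  Hence w = v or w ∈ N(v), and weak
-- simpliciality of v in G_{i+1} makes the neighbourhoods (within G_{i+1}) of
-- any two vertices of N(v) comparable.  For x, y in R ∩ N(v), or in N²(v), this
-- rules out a pair of hyperedges of Δ_{i+1} separating x from y and y from x.
-- In a minimal transversal two distinct elements always admit such a pair,
-- since otherwise one of them could be dropped.

open import Defs
open import Level using (0ℓ)
open import Data.Nat using (ℕ; suc; _≤_; _<_; s≤s⁻¹)
open import Data.Nat.Properties using (≤∧≢⇒<)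
open import Data.Fin using (Fin; fromℕ<; toℕ)
open import Data.Fin.Properties using (_≟_; toℕ-fromℕ<; toℕ-injective)
open import Data.Product using (_×_; _,_; proj₁; proj₂; ∃)
open import Data.Sum using (_⊎_; inj₁; inj₂)
open import Data.Empty using (⊥; ⊥-elim)
open import Function using (_∘_)
open import Relation.Nullary using (¬_; Dec; yes; no)
open import Relation.Nullary.Decidable using (T?; _⊎-dec_; decidable-stable)
open import Relation.Binary.PropositionalEquality using (_≡_; _≢_; refl; sym; subst)
open import Relation.Unary using (Pred; _∩_; _∈_; _∉_; _⊆_)

Separates : ∀ {n} → (Fin n → Pred (Fin n) 0ℓ) → Pred (Fin n) 0ℓ → Fin n → Fin n → Set
Separates E idx x y = ∃ λ w → w ∈ idx × x ∈ E w × y ∉ E w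

Crossing : ∀ {n} → (Fin n → Pred (Fin n) 0ℓ) → Pred (Fin n) 0ℓ → Fin n → Fin n → Set
Crossing E idx x y = Separates E idx x y × Separates E idx y x

comparable⇒¬crossing : ∀ {A : Set} {P Q : Pred A 0ℓ} {a b : A} →
  P ⊆ Q ⊎ Q ⊆ P → a ∈ P → a ∉ Q → b ∈ Q → b ∉ P → ⊥
comparable⇒¬crossing (inj₁ P⊆Q) a∈P a∉Q _ _ = a∉Q (P⊆Q a∈P)
comparable⇒¬crossing (inj₂ Q⊆P) _ _ b∈Q b∉P = b∉P (Q⊆P b∈Q)

module _ {n} {E : Fin n → Pred (Fin n) 0ℓ} {idx Z : Pred (Fin n) 0ℓ}
         (Z-min : IsMinTransversal E idx Z) where

  minTransversal-irredundant : ∀ {x} → x ∈ Z →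
    ¬ (∀ {w} → w ∈ idx → x ∈ E w → ∃ λ z → z ∈ Z × z ≢ x × z ∈ E w)
  minTransversal-irredundant {x} x∈Z covered =
    proj₂ (proj₂ Z-min Z∖x proj₁ Z∖x-transversal x∈Z) refl
    where
    Z∖x : Pred (Fin n) 0ℓ
    Z∖x u = u ∈ Z × u ≢ x

    Z∖x-transversal : IsTransversal E idx Z∖x
    Z∖x-transversal w w∈idx with proj₁ Z-min w w∈idx
    ... | z , z∈Z , z∈w with z ≟ x
    ...   | no z≢x = z , (z∈Z , z≢x) , z∈w
    ...   | yes refl with covered w∈idx z∈w
    ...     | z' , z'∈Z , z'≢x , z'∈w = z' , (z'∈Z , z'≢x) , z'∈w

  minTransversal-undominated : ∀ {x y} → x ∈ Z → y ∈ Z → x ≢ y →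
    ¬ (∀ {w} → w ∈ idx → x ∈ E w → y ∈ E w)
  minTransversal-undominated x∈Z y∈Z x≢y dominated =
    minTransversal-irredundant x∈Z λ w∈idx x∈w → _ , y∈Z , x≢y ∘ sym , dominated w∈idx x∈w

  minTransversal-atMostOne : (∀ w u → Dec (u ∈ E w)) → {S : Pred (Fin n) 0ℓ} →
    (∀ {x y} → x ∈ S → y ∈ S → ¬ Crossing E idx x y) → AtMostOne (Z ∩ S)
  minTransversal-atMostOne E? ¬crossing x y (x∈Z , x∈S) (y∈Z , y∈S) with x ≟ y
  ... | yes x≡y = x≡y
  ... | no x≢y = ⊥-elim (minTransversal-undominated x∈Z y∈Z x≢y x⇒y)
    where
    x⇒y : ∀ {w} → w ∈ idx → x ∈ E w → y ∈ E w
    x⇒y {w} w∈idx x∈w with E? w y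
    ... | yes y∈w = y∈w
    ... | no y∉w = ⊥-elim (minTransversal-undominated y∈Z x∈Z (x≢y ∘ sym) y⇒x)
      where
      y⇒x : ∀ {w'} → w' ∈ idx → y ∈ E w' → x ∈ E w'
      y⇒x {w'} w'∈idx y∈w' = decidable-stable (E? w' x) λ x∉w' →
        ¬crossing x∈S y∈S ((w , w∈idx , x∈w , y∉w) , (w' , w'∈idx , y∈w' , x∉w'))

module Step {n} (G : Graph n) (v : Fin n)
            (v-ws : WeakSimplicialIn G (suc (toℕ v)) v)
            (T⋆ : Pred (Fin n) 0ℓ) (T⋆-tr : IsTransversal (N[_] G) (H-idx G (toℕ v)) T⋆) where
  open Graph G using (adj) renaming (sym to adj-sym)

  N₊ : Fin n → Pred (Fin n) 0ℓ
  N₊ = Nind G (suc (toℕ v))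

  Δ : Pred (Fin n) 0ℓ
  Δ = Δ-idx G (suc (toℕ v)) T⋆

  N[]? : ∀ w u → Dec (u ∈ N[_] G w)
  N[]? w u = (u ≟ w) ⊎-dec T? (adj w u)

  Δ-edge-⊆ : ∀ {w u} → w ∈ Δ → u ∈ N[_] G w → u ∈ V G (suc (toℕ v))
  Δ-edge-⊆ (w∈H , _) = w∈H

  Δ-edge-∋v : ∀ {w} → w ∈ Δ → v ∈ N[_] G w
  Δ-edge-∋v {w} w∈Δ@(_ , avoids-T⋆) = decidable-stable (N[]? w v) λ v∉w →
    let (x , x∈T⋆ , x∈w) = T⋆-tr w (below-v v∉w) in avoids-T⋆ x x∈w x∈T⋆
    where
    below-v : v ∉ N[_] G w → N[_] G w ⊆ V G (toℕ v)
    below-v v∉w u∈w = ≤∧≢⇒< (s≤s⁻¹ (Δ-edge-⊆ w∈Δ u∈w))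
      λ u≡v → v∉w (subst (_∈ N[_] G w) (toℕ-injective u≡v) u∈w)

  RN-⊆-N₊v : Rset G (suc (toℕ v)) T⋆ v ∩ N G v ⊆ N₊ v
  RN-⊆-N₊v (((_ , w∈Δ , x∈w) , _) , v~x) = Δ-edge-⊆ w∈Δ x∈w , v~x

  RN-edge-centre : ∀ {x w} → x ∈ Rset G (suc (toℕ v)) T⋆ v ∩ N G v →
    w ∈ Δ → x ∈ N[_] G w → w ∈ N₊ x
  RN-edge-centre ((_ , x∉B) , v~x) w∈Δ (inj₁ refl) = ⊥-elim (x∉B (v~x , w∈Δ))
  RN-edge-centre _ w∈Δ (inj₂ w~x) = Δ-edge-⊆ w∈Δ (inj₁ refl) , adj-sym _ _ w~x

  RN-¬crossing : ∀ {x y} → x ∈ Rset G (suc (toℕ v)) T⋆ v ∩ N G v →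
    y ∈ Rset G (suc (toℕ v)) T⋆ v ∩ N G v → ¬ Crossing (N[_] G) Δ x y
  RN-¬crossing {x} {y} x∈RN y∈RN ((w , w∈Δ , x∈w , y∉w) , (w' , w'∈Δ , y∈w' , x∉w')) =
    comparable⇒¬crossing (proj₂ v-ws x y (RN-⊆-N₊v x∈RN) (RN-⊆-N₊v y∈RN))
      (RN-edge-centre x∈RN w∈Δ x∈w) (λ (_ , y~w) → y∉w (inj₂ (adj-sym _ _ y~w)))
      (RN-edge-centre y∈RN w'∈Δ y∈w') (λ (_ , x~w') → x∉w' (inj₂ (adj-sym _ _ x~w')))

  N²-edge-centre : ∀ {x w} → x ∈ N² G v → w ∈ Δ → x ∈ N[_] G w → w ∈ N₊ v × x ∈ N₊ w
  N²-edge-centre (_ , x∉N[v]) w∈Δ x∈w with Δ-edge-∋v w∈Δ | x∈w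
  ... | inj₁ refl | _ = ⊥-elim (x∉N[v] x∈w)
  ... | inj₂ w~v | inj₁ refl = ⊥-elim (x∉N[v] (inj₂ (adj-sym _ _ w~v)))
  ... | inj₂ w~v | inj₂ w~x =
    (Δ-edge-⊆ w∈Δ (inj₁ refl) , adj-sym _ _ w~v) , (Δ-edge-⊆ w∈Δ x∈w , w~x)

  N²-¬crossing : ∀ {x y} → x ∈ N² G v → y ∈ N² G v → ¬ Crossing (N[_] G) Δ x y
  N²-¬crossing x∈N² y∈N² ((w , w∈Δ , x∈w , y∉w) , (w' , w'∈Δ , y∈w' , x∉w'))
    with N²-edge-centre x∈N² w∈Δ x∈w | N²-edge-centre y∈N² w'∈Δ y∈w'
  ... | w∈N₊v , x∈N₊w | w'∈N₊v , y∈N₊w' =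
    comparable⇒¬crossing (proj₂ v-ws w w' w∈N₊v w'∈N₊v)
      x∈N₊w (λ (_ , w'~x) → x∉w' (inj₂ w'~x))
      y∈N₊w' (λ (_ , w~y) → y∉w (inj₂ w~y))

  RN-atMostOne : ∀ {Z} → IsMinTransversal (N[_] G) Δ Z →
    AtMostOne (Z ∩ (Rset G (suc (toℕ v)) T⋆ v ∩ N G v))
  RN-atMostOne Z-min = minTransversal-atMostOne Z-min N[]? RN-¬crossing

  N²-atMostOne : ∀ {Z} → IsMinTransversal (N[_] G) Δ Z → AtMostOne (Z ∩ N² G v)
  N²-atMostOne Z-min = minTransversal-atMostOne Z-min N[]? N²-¬crossing

proposition15-at : ∀ {n} (G : Graph n) → IsWSEO G → (i : ℕ) (v : Fin n) → toℕ v ≡ i →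
    (T⋆ : Pred (Fin n) 0ℓ) → IsTransversal (N[_] G) (H-idx G i) T⋆ →
    (Z : Pred (Fin n) 0ℓ) → IsMinTransversal (N[_] G) (Δ-idx G (suc i) T⋆) Z →
    AtMostOne (Z ∩ (Rset G (suc i) T⋆ v ∩ N G v)) × AtMostOne (Z ∩ N² G v)
proposition15-at G wseo _ v refl T⋆ T⋆-tr Z Z-min = RN-atMostOne Z-min , N²-atMostOne Z-min
  where open Step G v (wseo v) T⋆ T⋆-tr

proposition15 : ∀ {n} (G : Graph n) → IsChordalBipartite G → IsWSEO G →
    (i : ℕ) → 1 ≤ i → (i<n : i < n) →
    (T⋆ : Pred (Fin n) 0ℓ) → IsMinTransversal (N[_] G) (H-idx G i) T⋆ →
    (Z : Pred (Fin n) 0ℓ) → IsMinTransversal (N[_] G) (Δ-idx G (suc i) T⋆) Z →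
    AtMostOne (Z ∩ (Rset G (suc i) T⋆ (fromℕ< i<n) ∩ N G (fromℕ< i<n)))
    × AtMostOne (Z ∩ N² G (fromℕ< i<n))
proposition15 G _ wseo i _ i<n T⋆ (T⋆-tr , _) =
  proposition15-at G wseo i (fromℕ< i<n) (toℕ-fromℕ< i<n) T⋆ T⋆-tr
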